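{- Let $(G,c,\mathcal{H},k)$ be an instance of Weighted Green Bridges with $G=(V,E)$, $c\colon E\to\mathbb{N}$, and $\mathcal{H}=\{H_1,\dots,H_r\}$, in which every habitat induces a cycle in $G$. Consider the algorithm that, for each $i\in\{1,\dots,r\}$, computes a minimum-cost spanning tree $F_i$ of $G[H_i]$ and outputs $F=\bigcup_{i=1}^r F_i$. Then $F$ is feasible (for every $i$, $H_i\subseteq V(G[F])$ and $G[F][H_i]$ is connected) and $c(F)\le \mathrm{OPT}+r\cdot c_{\max}$, where $\mathrm{OPT}$ is the minimum of $c(F')$ over all feasible $F'\subseteq E$ and $c_{\max}=\max_{e\in E}c(e)$.
   Context: Weighted Green Bridges: given $G$, $c$, habitats $H_i\subseteq V$ with $|H_i|\ge2$, and $k$, decide whether some $F\subseteq E$ with $c(F)=\sum_{e\in F}c(e)\le k$ satisfies $H_i\subseteq V(G[F])$ and $G[F][H_i]$ connected for all $i$. For $F\subseteq E$, $G[F]$ is the graph with vertex set $\bigcup_{e\in F}e$ and edge set $F$; $G[F][V']$ is the subgraph of $G[F]$ induced by $V'$. A habitat $H$ induces a cycle if $G[H]$ is a cycle. -}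

module Defs where

open import Data.Nat using (ℕ; _+_; _*_; _≤_; _⊔_; suc; zero)
open import Data.Fin using (Fin; toℕ)
open import Data.Fin.Subset using (Subset; _∈_; ∣_∣; ⋃)
open import Data.Product using (Σ; ∃; ∃-syntax; _×_; _,_)
open import Data.Sum using (_⊎_)
open import Data.Bool using (if_then_else_)
open import Data.Vec using (lookup)
open import Data.List using (List; map; foldr; allFin; tabulate)
open import Data.Nat.ListAction using (sum)
open import Relation.Binary.PropositionalEquality using (_≡_; _≢_)
open import Function.Definitions using (Injective)

-- A finite simple undirected graph with vertex set Fin n and edge set Fin m;
-- edge e joins src e and tgt e (orientation irrelevant).
record Graph (n m : ℕ) : Set where
  field
    src tgt : Fin m → Fin n
    noLoop  : ∀ e → src e ≢ tgt e
    noMulti : ∀ e f →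
      ((src e ≡ src f × tgt e ≡ tgt f) ⊎ (src e ≡ tgt f × tgt e ≡ src f)) → e ≡ f

open Graph public

module _ {n m : ℕ} (G : Graph n m) where

  Joins : Fin m → Fin n → Fin n → Set
  Joins e u v = (src G e ≡ u × tgt G e ≡ v) ⊎ (src G e ≡ v × tgt G e ≡ u)

  InVertices : Subset m → Fin n → Set
  InVertices F v = ∃[ e ] (e ∈ F × (src G e ≡ v ⊎ tgt G e ≡ v))

  data Walk (F : Subset m) (H : Subset n) : Fin n → Fin n → Set where
    []   : ∀ {v} → Walk F H v v
    step : ∀ {u w v} (e : Fin m) → e ∈ F → Joins e u w → u ∈ H → w ∈ H →
           Walk F H w v → Walk F H u v

  -- G[F][H] is connected (H is nonempty in all uses: |H| ≥ 2)
  Connected : Subset m → Subset n → Set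
  Connected F H = ∀ u v → u ∈ H → v ∈ H → Walk F H u v

  Feasible : ∀ {r} → (Fin r → Subset n) → Subset m → Set
  Feasible Hs F = ∀ i → (∀ v → v ∈ Hs i → InVertices F v) × Connected F (Hs i)

CycSucc : ∀ {l} → Fin l → Fin l → Set
CycSucc {l} i j = (toℕ j ≡ suc (toℕ i)) ⊎ (suc (toℕ i) ≡ l × toℕ j ≡ 0)

module _ {n m : ℕ} (G : Graph n m) where

  InducesCycle : Subset n → Set
  InducesCycle H = Σ ℕ λ l → (3 ≤ l) × Σ (Fin l → Fin n) λ v →
      Injective _≡_ _≡_ v
    × (∀ x → (x ∈ H → ∃[ i ] v i ≡ x) × (∃[ i ] v i ≡ x → x ∈ H))
    × (∀ i j → ((∃[ e ] Joins G e (v i) (v j)) → (CycSucc i j ⊎ CycSucc j i))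
             × ((CycSucc i j ⊎ CycSucc j i) → ∃[ e ] Joins G e (v i) (v j)))

  HasCycle : Subset m → Set
  HasCycle F = Σ ℕ λ l → (3 ≤ l) × Σ (Fin l → Fin n) λ v →
      Injective _≡_ _≡_ v
    × (∀ i j → CycSucc i j → ∃[ e ] (e ∈ F × Joins G e (v i) (v j)))

  IsSpanningTree : Subset n → Subset m → Set
  IsSpanningTree H F =
      (∀ e → e ∈ F → src G e ∈ H × tgt G e ∈ H)
    × Connected G F H
    × (HasCycle F → Data.Empty.⊥)
    where import Data.Empty

module _ {m : ℕ} (c : Fin m → ℕ) where

  cost : Subset m → ℕ
  cost F = sum (map (λ e → if lookup F e then c e else 0) (allFin m))

  -- c_max = max_{e ∈ E} c(e)  (0 if E = ∅)
  cmax : ℕ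
  cmax = foldr _⊔_ 0 (map c (allFin m))

module _ {n m : ℕ} (G : Graph n m) (c : Fin m → ℕ) where

  IsMinSpanningTree : Subset n → Subset m → Set
  IsMinSpanningTree H F =
    IsSpanningTree G H F × (∀ T → IsSpanningTree G H T → cost c F ≤ cost c T)

  IsOPT : ∀ {r} → (Fin r → Subset n) → ℕ → Set
  IsOPT Hs opt = (∃[ F ] (Feasible G Hs F × cost c F ≡ opt))
               × (∀ F → Feasible G Hs F → opt ≤ cost c F)

⋃ᶠ : ∀ {r m} → (Fin r → Subset m) → Subset m
⋃ᶠ Fs = ⋃ (tabulate Fs)

-- If G[H] is a cycle and G[B][H] is connected, then B misses at most one edge of the cycle:
-- removing two cycle edges splits H into two arcs, and since G[H] is induced no chord
-- rejoins them. Each tree F_i lies inside the cycle G[H_i], so for an optimal B every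
-- F_i ∖ B has at most one edge and c(⋃ F_i) ≤ c(B ∪ ⋃ (F_i ∖ B)) ≤ OPT + r · c_max.
-- Feasibility holds because F_i already connects H_i, which has at least two vertices.

module Submission where

open import Defs
open import Data.Nat using (ℕ; _+_; _*_; _≤_)
open import Data.Fin using (Fin)
open import Data.Fin.Subset using (Subset; ∣_∣)
open import Data.Product using (_×_)

open import Algebra.Properties.CommutativeSemigroup using (interchange)
open import Data.Bool using (true; false; if_then_else_)
open import Data.Empty using (⊥-elim)
open import Data.Fin using (zero; suc; toℕ; punchIn)
open import Data.Fin.Properties using (suc-injective; toℕ-injective; toℕ<n; punchInᵢ≢i)
open import Data.Fin.Subset using (_∈_; _∉_; _⊆_; _∪_; _─_; ⊥; outside)
open import Data.Fin.Subset.Properties using (_∈?_; ∉⊥; x∈p∪q⁻; x∈p∪q⁺; x∈p∧x∉q⇒x∈p─q)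
open import Data.List using ([]; _∷_; map; foldr; tabulate; allFin)
open import Data.List.Properties using (map-tabulate)
open import Data.Nat using (zero; suc; _<_; _⊔_; z≤n; s≤s; _≟_)
open import Data.Nat.ListAction using (sum)
open import Data.Nat.Properties
  using ( ≤-refl; ≤-reflexive; ≤-trans; ≤-antisym; ≤-pred; <⇒≤; <⇒≢; <-irrefl; ≤-<-trans; <-cmp; n≮0; n<1+n
        ; m<n⇒m<1+n; m≤n⇒m<n∨m≡n; m≤m+n; m≤n+m; m≤m⊔n; m≤n⊔m; +-identityʳ; +-mono-≤; +-monoʳ-≤
        ; +-commutativeSemigroup; module ≤-Reasoning )
open import Data.Product using (∃-syntax; _,_; proj₁; proj₂)
open import Data.Sum using (_⊎_; inj₁; inj₂)
open import Data.Vec using (_∷_; lookup; here; there)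
open import Data.Vec.Properties using ([]=⇒lookup; lookup⇒[]=)
open import Function using (_∘_; id)
open import Function.Definitions using (Injective)
open import Relation.Binary.Definitions using (tri<; tri≈; tri>)
open import Relation.Binary.PropositionalEquality
open import Relation.Nullary using (¬_; yes; no; contradiction)

sum-map-mono : ∀ {A : Set} {f g : A → ℕ} → (∀ x → f x ≤ g x) →
               ∀ xs → sum (map f xs) ≤ sum (map g xs)
sum-map-mono f≤g []       = z≤n
sum-map-mono f≤g (x ∷ xs) = +-mono-≤ (f≤g x) (sum-map-mono f≤g xs)

sum-map-+ : ∀ {A : Set} (f g : A → ℕ) xs →
            sum (map (λ x → f x + g x) xs) ≡ sum (map f xs) + sum (map g xs)
sum-map-+ f g []       = refl
sum-map-+ f g (x ∷ xs) = begin
  f x + g x + sum (map (λ y → f y + g y) xs)     ≡⟨ cong (f x + g x +_) (sum-map-+ f g xs) ⟩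
  f x + g x + (sum (map f xs) + sum (map g xs))  ≡⟨ interchange +-commutativeSemigroup (f x) (g x) _ _ ⟩
  f x + sum (map f xs) + (g x + sum (map g xs))  ∎
  where open ≡-Reasoning

sum-tabulate-≡0 : ∀ n {f : Fin n → ℕ} → (∀ i → f i ≡ 0) → sum (tabulate f) ≡ 0
sum-tabulate-≡0 zero    f≡0 = refl
sum-tabulate-≡0 (suc n) f≡0 = cong₂ _+_ (f≡0 zero) (sum-tabulate-≡0 n (f≡0 ∘ suc))

sum-tabulate-≤-max : ∀ n {f g : Fin n → ℕ} → (∀ i → f i ≤ g i) →
                     (∀ {i j} → f i ≢ 0 → f j ≢ 0 → i ≡ j) →
                     sum (tabulate f) ≤ foldr _⊔_ 0 (tabulate g)
sum-tabulate-≤-max zero    f≤g single = z≤n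
sum-tabulate-≤-max (suc n) {f} {g} f≤g single with f zero ≟ 0
... | yes f₀≡0 = begin
  f zero + sum (tabulate (f ∘ suc))  ≡⟨ cong (_+ sum (tabulate (f ∘ suc))) f₀≡0 ⟩
  sum (tabulate (f ∘ suc))           ≤⟨ sum-tabulate-≤-max n (f≤g ∘ suc) (λ p q → suc-injective (single p q)) ⟩
  foldr _⊔_ 0 (tabulate (g ∘ suc))   ≤⟨ m≤n⊔m (g zero) _ ⟩
  g zero ⊔ foldr _⊔_ 0 (tabulate (g ∘ suc)) ∎
  where open ≤-Reasoning
... | no f₀≢0 = begin
  f zero + sum (tabulate (f ∘ suc))  ≡⟨ cong (f zero +_) (sum-tabulate-≡0 n tail≡0) ⟩
  f zero + 0                         ≡⟨ +-identityʳ (f zero) ⟩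
  f zero                             ≤⟨ f≤g zero ⟩
  g zero                             ≤⟨ m≤m⊔n (g zero) _ ⟩
  g zero ⊔ foldr _⊔_ 0 (tabulate (g ∘ suc)) ∎
  where
  open ≤-Reasoning
  tail≡0 : ∀ i → f (suc i) ≡ 0
  tail≡0 i with f (suc i) ≟ 0
  ... | yes fᵢ≡0 = fᵢ≡0
  ... | no fᵢ≢0  = contradiction (single f₀≢0 fᵢ≢0) λ ()

x∈p─q⁻ : ∀ {n x} (p q : Subset n) → x ∈ p ─ q → x ∈ p × x ∉ q
x∈p─q⁻ (_ ∷ p) (outside ∷ q) here          = here , λ ()
x∈p─q⁻ (_ ∷ p) (_ ∷ q)       (there x∈p─q) with x∈p─q⁻ p q x∈p─q
... | x∈p , x∉q = there x∈p , λ { (there x∈q) → x∉q x∈q }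

AtMostOne : ∀ {n} → Subset n → Set
AtMostOne X = ∀ {x y} → x ∈ X → y ∈ X → x ≡ y

∈-⋃ᶠ⁺ : ∀ {r m} (Xs : Fin r → Subset m) i {e} → e ∈ Xs i → e ∈ ⋃ᶠ Xs
∈-⋃ᶠ⁺ Xs zero    e∈X = x∈p∪q⁺ (inj₁ e∈X)
∈-⋃ᶠ⁺ Xs (suc i) e∈X = x∈p∪q⁺ (inj₂ (∈-⋃ᶠ⁺ (Xs ∘ suc) i e∈X))

∈-⋃ᶠ⁻ : ∀ {r m} (Xs : Fin r → Subset m) {e} → e ∈ ⋃ᶠ Xs → ∃[ i ] e ∈ Xs i
∈-⋃ᶠ⁻ {zero}  Xs e∈⊥ = contradiction e∈⊥ ∉⊥
∈-⋃ᶠ⁻ {suc r} Xs e∈⋃ with x∈p∪q⁻ (Xs zero) (⋃ᶠ (Xs ∘ suc)) e∈⋃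
... | inj₁ e∈X₀ = zero , e∈X₀
... | inj₂ e∈⋃′ with ∈-⋃ᶠ⁻ (Xs ∘ suc) e∈⋃′
...   | i , e∈Xᵢ = suc i , e∈Xᵢ

⋃ᶠ⊆∪⋃ᶠ─ : ∀ {r m} (Xs : Fin r → Subset m) (B : Subset m) → ⋃ᶠ Xs ⊆ B ∪ ⋃ᶠ (λ i → Xs i ─ B)
⋃ᶠ⊆∪⋃ᶠ─ Xs B {e} e∈⋃ with e ∈? B | ∈-⋃ᶠ⁻ Xs e∈⋃
... | yes e∈B | _         = x∈p∪q⁺ (inj₁ e∈B)
... | no e∉B  | i , e∈Xᵢ = x∈p∪q⁺ (inj₂ (∈-⋃ᶠ⁺ (λ j → Xs j ─ B) i (x∈p∧x∉q⇒x∈p─q e∈Xᵢ e∉B)))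

module _ {m : ℕ} (c : Fin m → ℕ) where

  weight : Subset m → Fin m → ℕ
  weight X e = if lookup X e then c e else 0

  weight-∈ : ∀ {X e} → e ∈ X → weight X e ≡ c e
  weight-∈ e∈X rewrite []=⇒lookup e∈X = refl

  weight-∉ : ∀ {X e} → e ∉ X → weight X e ≡ 0
  weight-∉ {X} {e} e∉X with lookup X e in eq
  ... | true  = contradiction (lookup⇒[]= e X eq) e∉X
  ... | false = refl

  weight-⊆ : ∀ {X Y} → X ⊆ Y → ∀ e → weight X e ≤ weight Y e
  weight-⊆ {X} X⊆Y e with e ∈? X
  ... | yes e∈X rewrite weight-∈ e∈X | weight-∈ (X⊆Y e∈X) = ≤-refl
  ... | no e∉X  rewrite weight-∉ e∉X = z≤n

  weight-∪ : ∀ X Y e → weight (X ∪ Y) e ≤ weight X e + weight Y e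
  weight-∪ X Y e with e ∈? X ∪ Y
  ... | no e∉X∪Y rewrite weight-∉ e∉X∪Y = z≤n
  ... | yes e∈X∪Y rewrite weight-∈ e∈X∪Y with x∈p∪q⁻ X Y e∈X∪Y
  ...   | inj₁ e∈X rewrite weight-∈ e∈X = m≤m+n (c e) _
  ...   | inj₂ e∈Y rewrite weight-∈ e∈Y = m≤n+m (c e) _

  cost-⊆ : ∀ {X Y} → X ⊆ Y → cost c X ≤ cost c Y
  cost-⊆ X⊆Y = sum-map-mono (weight-⊆ X⊆Y) (allFin m)

  cost-∪ : ∀ X Y → cost c (X ∪ Y) ≤ cost c X + cost c Y
  cost-∪ X Y = ≤-trans (sum-map-mono (weight-∪ X Y) (allFin m))
                       (≤-reflexive (sum-map-+ (weight X) (weight Y) (allFin m)))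

  cost-⊥ : cost c ⊥ ≡ 0
  cost-⊥ = trans (cong sum (map-tabulate id (weight ⊥)))
                 (sum-tabulate-≡0 m (λ e → weight-∉ ∉⊥))

  cost-⋃ᶠ-≤ : ∀ {r} (Xs : Fin r → Subset m) {K} → (∀ i → cost c (Xs i) ≤ K) → cost c (⋃ᶠ Xs) ≤ r * K
  cost-⋃ᶠ-≤ {zero}  Xs Xᵢ≤K = ≤-reflexive cost-⊥
  cost-⋃ᶠ-≤ {suc r} Xs Xᵢ≤K = ≤-trans (cost-∪ (Xs zero) (⋃ᶠ (Xs ∘ suc)))
                                      (+-mono-≤ (Xᵢ≤K zero) (cost-⋃ᶠ-≤ (Xs ∘ suc) (Xᵢ≤K ∘ suc)))

  cost-≤-cmax : ∀ {X} → AtMostOne X → cost c X ≤ cmax c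
  cost-≤-cmax {X} single = subst₂ _≤_
    (cong sum (sym (map-tabulate id (weight X))))
    (cong (foldr _⊔_ 0) (sym (map-tabulate id c)))
    (sum-tabulate-≤-max m weight≤c (λ p q → single (nonzero⇒∈ p) (nonzero⇒∈ q)))
    where
    weight≤c : ∀ e → weight X e ≤ c e
    weight≤c e with e ∈? X
    ... | yes e∈X rewrite weight-∈ e∈X = ≤-refl
    ... | no e∉X  rewrite weight-∉ e∉X = z≤n
    nonzero⇒∈ : ∀ {e} → weight X e ≢ 0 → e ∈ X
    nonzero⇒∈ {e} w≢0 with e ∈? X
    ... | yes e∈X = e∈X
    ... | no e∉X  = contradiction (weight-∉ e∉X) w≢0

  cost-⋃ᶠ-≤-+cmax : ∀ {r} (Xs : Fin r → Subset m) B → (∀ i → AtMostOne (Xs i ─ B)) →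
                    cost c (⋃ᶠ Xs) ≤ cost c B + r * cmax c
  cost-⋃ᶠ-≤-+cmax {r} Xs B few = begin
    cost c (⋃ᶠ Xs)                               ≤⟨ cost-⊆ (⋃ᶠ⊆∪⋃ᶠ─ Xs B) ⟩
    cost c (B ∪ ⋃ᶠ (λ i → Xs i ─ B))             ≤⟨ cost-∪ B _ ⟩
    cost c B + cost c (⋃ᶠ (λ i → Xs i ─ B))      ≤⟨ +-monoʳ-≤ (cost c B) (cost-⋃ᶠ-≤ _ (cost-≤-cmax ∘ few)) ⟩
    cost c B + r * cmax c                        ∎
    where open ≤-Reasoning

module _ {n m : ℕ} (G : Graph n m) where

  Joins-sym : ∀ {e x y} → Joins G e x y → Joins G e y x
  Joins-sym (inj₁ (s , t)) = inj₂ (s , t)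
  Joins-sym (inj₂ (s , t)) = inj₁ (s , t)

  Joins-unique : ∀ {e f x y} → Joins G e x y → Joins G f x y → e ≡ f
  Joins-unique {e} {f} (inj₁ (s , t)) (inj₁ (s′ , t′)) = noMulti G e f (inj₁ (trans s (sym s′) , trans t (sym t′)))
  Joins-unique {e} {f} (inj₁ (s , t)) (inj₂ (s′ , t′)) = noMulti G e f (inj₂ (trans s (sym t′) , trans t (sym s′)))
  Joins-unique {e} {f} (inj₂ (s , t)) (inj₁ (s′ , t′)) = noMulti G e f (inj₂ (trans s (sym t′) , trans t (sym s′)))
  Joins-unique {e} {f} (inj₂ (s , t)) (inj₂ (s′ , t′)) = noMulti G e f (inj₁ (trans s (sym s′) , trans t (sym t′)))

  walk-⊆ : ∀ {X Y H u v} → X ⊆ Y → Walk G X H u v → Walk G Y H u v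
  walk-⊆ X⊆Y []                         = []
  walk-⊆ X⊆Y (step e e∈X j u∈H w∈H walk) = step e (X⊆Y e∈X) j u∈H w∈H (walk-⊆ X⊆Y walk)

  connected-⊆ : ∀ {X Y H} → X ⊆ Y → Connected G X H → Connected G Y H
  connected-⊆ X⊆Y conn u v u∈H v∈H = walk-⊆ X⊆Y (conn u v u∈H v∈H)

  walk-start-covered : ∀ {X H u v} → Walk G X H u v → u ≢ v → InVertices G X u
  walk-start-covered []                                  u≢u = contradiction refl u≢u
  walk-start-covered (step e e∈X (inj₁ (s , _)) _ _ _) _ = e , e∈X , inj₁ s
  walk-start-covered (step e e∈X (inj₂ (_ , t)) _ _ _) _ = e , e∈X , inj₂ t

  connected-covers : ∀ {X H} → Connected G X H → (∀ u → u ∈ H → ∃[ w ] (w ∈ H × u ≢ w)) →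
                     ∀ u → u ∈ H → InVertices G X u
  connected-covers conn nontrivial u u∈H with nontrivial u u∈H
  ... | w , w∈H , u≢w = walk-start-covered (conn u w u∈H w∈H) u≢w

  ⋃ᶠ-feasible : ∀ {r} {Hs : Fin r → Subset n} {Fs : Fin r → Subset m} →
                (∀ i → IsSpanningTree G (Hs i) (Fs i)) →
                (∀ i u → u ∈ Hs i → ∃[ w ] (w ∈ Hs i × u ≢ w)) →
                Feasible G Hs (⋃ᶠ Fs)
  ⋃ᶠ-feasible {Hs = Hs} {Fs} trees nontrivial i = connected-covers conn (nontrivial i) , conn
    where
    conn : Connected G (⋃ᶠ Fs) (Hs i)
    conn = connected-⊆ (∈-⋃ᶠ⁺ Fs i) (proj₁ (proj₂ (trees i)))

  InducesCycle⇒nontrivial : ∀ {H} → InducesCycle G H → ∀ u → u ∈ H → ∃[ w ] (w ∈ H × u ≢ w)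
  InducesCycle⇒nontrivial (_ , s≤s (s≤s _) , v , v-injective , onto , _) u u∈H with proj₁ (onto u) u∈H
  ... | i , refl = v j , proj₂ (onto (v j)) (j , refl) , λ vi≡vj → punchInᵢ≢i i zero (sym (v-injective vi≡vj))
    where
    j : Fin _
    j = punchIn i zero

CycSucc-functional : ∀ {l} {a b b′ : Fin l} → CycSucc a b → CycSucc a b′ → b ≡ b′
CycSucc-functional (inj₁ b≡1+a)       (inj₁ b′≡1+a)      = toℕ-injective (trans b≡1+a (sym b′≡1+a))
CycSucc-functional {b = b} (inj₁ b≡1+a) (inj₂ (1+a≡l , _)) = contradiction (trans b≡1+a 1+a≡l) (<⇒≢ (toℕ<n b))
CycSucc-functional {b′ = b′} (inj₂ (1+a≡l , _)) (inj₁ b′≡1+a) = contradiction (trans b′≡1+a 1+a≡l) (<⇒≢ (toℕ<n b′))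
CycSucc-functional (inj₂ (_ , b≡0))    (inj₂ (_ , b′≡0))  = toℕ-injective (trans b≡0 (sym b′≡0))

module CycleGaps {n m} (G : Graph n m) {H : Subset n} {l} (v : Fin l → Fin n)
  (v-injective : Injective _≡_ _≡_ v)
  (v-onto : ∀ x → x ∈ H → ∃[ i ] v i ≡ x)
  (v-into : ∀ i → v i ∈ H)
  (adjacent⇒consecutive : ∀ i j → ∃[ e ] Joins G e (v i) (v j) → CycSucc i j ⊎ CycSucc j i)
  where

  EdgeAt : Fin m → Fin l → Set
  EdgeAt e a = ∃[ a′ ] (CycSucc a a′ × Joins G e (v a) (v a′))

  EdgeAt-unique : ∀ {e f a} → EdgeAt e a → EdgeAt f a → e ≡ f
  EdgeAt-unique (_ , a→a′ , e-joins) (_ , a→a″ , f-joins) rewrite CycSucc-functional a→a′ a→a″ =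
    Joins-unique G e-joins f-joins

  EdgeAt-exists : ∀ {e} → src G e ∈ H × tgt G e ∈ H → ∃[ a ] EdgeAt e a
  EdgeAt-exists {e} (s∈H , t∈H) with v-onto _ s∈H | v-onto _ t∈H
  ... | i , vi≡s | j , vj≡t with adjacent⇒consecutive i j (e , inj₁ (sym vi≡s , sym vj≡t))
  ...   | inj₁ i→j = i , j , i→j , inj₁ (sym vi≡s , sym vj≡t)
  ...   | inj₂ j→i = j , i , j→i , inj₂ (sym vi≡s , sym vj≡t)

  ∉-EdgeAt : ∀ {B f g x i} → f ∈ B → g ∉ B → EdgeAt g x → toℕ i ≡ toℕ x → ¬ EdgeAt f i
  ∉-EdgeAt {B} f∈B g∉B g-at i≡x f-at with toℕ-injective i≡x
  ... | refl = g∉B (subst (_∈ B) (EdgeAt-unique f-at g-at) f∈B)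

  -- Removing the cycle edges at positions a < b cuts off the arc v (a+1), …, v b.
  module _ {B e e′ a b} (e∉B : e ∉ B) (e′∉B : e′ ∉ B) (a<b : toℕ a < toℕ b)
           (e-at-a : EdgeAt e a) (e′-at-b : EdgeAt e′ b) where

    InArc : Fin l → Set
    InArc i = toℕ a < toℕ i × toℕ i ≤ toℕ b

    arc-closed : ∀ {f i j} → f ∈ B → Joins G f (v i) (v j) → InArc i → InArc j
    arc-closed {f} {i} {j} f∈B joins (a<i , i≤b) with adjacent⇒consecutive i j (f , joins)
    ... | inj₁ (inj₁ j≡1+i) with m≤n⇒m<n∨m≡n i≤b
    ...   | inj₁ i<b rewrite j≡1+i = m<n⇒m<1+n a<i , i<b
    ...   | inj₂ i≡b = ⊥-elim (∉-EdgeAt f∈B e′∉B e′-at-b i≡b (j , inj₁ j≡1+i , joins))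
    arc-closed {f} {i} {j} f∈B joins (a<i , i≤b) | inj₁ (inj₂ (1+i≡l , j≡0)) =
      ⊥-elim (∉-EdgeAt f∈B e′∉B e′-at-b (≤-antisym i≤b (≤-pred (subst (toℕ b <_) (sym 1+i≡l) (toℕ<n b))))
                       (j , inj₂ (1+i≡l , j≡0) , joins))
    arc-closed {f} {i} {j} f∈B joins (a<i , i≤b) | inj₂ (inj₁ i≡1+j)
      with m≤n⇒m<n∨m≡n (≤-pred (subst (toℕ a <_) i≡1+j a<i))
    ... | inj₁ a<j = a<j , ≤-trans (<⇒≤ (subst (toℕ j <_) (sym i≡1+j) (n<1+n (toℕ j)))) i≤b
    ... | inj₂ a≡j = ⊥-elim (∉-EdgeAt f∈B e∉B e-at-a (sym a≡j) (i , inj₁ i≡1+j , Joins-sym G joins))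
    arc-closed f∈B joins (a<i , _) | inj₂ (inj₂ (_ , i≡0)) = ⊥-elim (n≮0 (subst (toℕ a <_) i≡0 a<i))

    walk-stays-in-arc : ∀ {x y} → Walk G B H x y → ∃[ i ] (v i ≡ x × InArc i) → ∃[ j ] (v j ≡ y × InArc j)
    walk-stays-in-arc []                                    start              = start
    walk-stays-in-arc (step {w = w} f f∈B joins _ w∈H walk) (i , refl , i∈arc) with v-onto w w∈H
    ... | j , refl = walk-stays-in-arc walk (j , refl , arc-closed f∈B joins i∈arc)

    successor-in-arc : ∀ {a′} → CycSucc a a′ → InArc a′
    successor-in-arc (inj₁ a′≡1+a) =
      subst (toℕ a <_) (sym a′≡1+a) (n<1+n (toℕ a)) , subst (_≤ toℕ b) (sym a′≡1+a) a<b
    successor-in-arc (inj₂ (1+a≡l , _)) =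
      ⊥-elim (<-irrefl refl (≤-<-trans a<b (subst (toℕ b <_) (sym 1+a≡l) (toℕ<n b))))

    two-gaps-disconnect : ¬ Connected G B H
    two-gaps-disconnect conn with walk-stays-in-arc (conn (v a′) (v a) (v-into a′) (v-into a))
                                                   (a′ , refl , successor-in-arc (proj₁ (proj₂ e-at-a)))
      where
      a′ : Fin l
      a′ = proj₁ e-at-a
    ... | j , vj≡va , a<j , _ = <-irrefl (cong toℕ (sym (v-injective vj≡va))) a<j

  at-most-one-gap : ∀ {B e e′} → Connected G B H → src G e ∈ H × tgt G e ∈ H → src G e′ ∈ H × tgt G e′ ∈ H →
                    e ∉ B → e′ ∉ B → e ≡ e′
  at-most-one-gap conn e∈H e′∈H e∉B e′∉B with EdgeAt-exists e∈H | EdgeAt-exists e′∈H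
  ... | a , e-at-a | b , e′-at-b with <-cmp (toℕ a) (toℕ b)
  ...   | tri< a<b _ _ = contradiction conn (two-gaps-disconnect e∉B e′∉B a<b e-at-a e′-at-b)
  ...   | tri> _ _ b<a = contradiction conn (two-gaps-disconnect e′∉B e∉B b<a e′-at-b e-at-a)
  ...   | tri≈ _ a≡b _ rewrite toℕ-injective a≡b = EdgeAt-unique e-at-a e′-at-b

InducesCycle⇒AtMostOne─ : ∀ {n m} (G : Graph n m) {H F B} → InducesCycle G H →
                          (∀ e → e ∈ F → src G e ∈ H × tgt G e ∈ H) → Connected G B H →
                          AtMostOne (F ─ B)
InducesCycle⇒AtMostOne─ G {F = F} {B} (_ , _ , v , v-injective , onto , adjacency) F⊆G[H] conn e∈F─B e′∈F─B
  with x∈p─q⁻ F B e∈F─B | x∈p─q⁻ F B e′∈F─B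
... | e∈F , e∉B | e′∈F , e′∉B = at-most-one-gap conn (F⊆G[H] _ e∈F) (F⊆G[H] _ e′∈F) e∉B e′∉B
  where
  open CycleGaps G v v-injective (λ x → proj₁ (onto x)) (λ i → proj₂ (onto (v i)) (i , refl))
                 (λ i j → proj₁ (adjacency i j))

mainTheorem10 : ∀ {n m r} (G : Graph n m) (c : Fin m → ℕ)
    (Hs : Fin r → Subset n) (k : ℕ)
    → (∀ i → 2 ≤ ∣ Hs i ∣)
    → (∀ i → InducesCycle G (Hs i))
    → (Fs : Fin r → Subset m)
    → (∀ i → IsMinSpanningTree G c (Hs i) (Fs i))
    → Feasible G Hs (⋃ᶠ Fs)
      × (∀ opt → IsOPT G c Hs opt → cost c (⋃ᶠ Fs) ≤ opt + r * cmax c)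
mainTheorem10 {r = r} G c Hs _ _ cycles Fs msts =
  ⋃ᶠ-feasible G trees (InducesCycle⇒nontrivial G ∘ cycles) , bounded
  where
  trees : ∀ i → IsSpanningTree G (Hs i) (Fs i)
  trees i = proj₁ (msts i)

  bounded : ∀ opt → IsOPT G c Hs opt → cost c (⋃ᶠ Fs) ≤ opt + r * cmax c
  bounded _ ((B , B-feasible , refl) , _) = cost-⋃ᶠ-≤-+cmax c Fs B λ i →
    InducesCycle⇒AtMostOne─ G (cycles i) (proj₁ (trees i)) (proj₂ (B-feasible i))
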